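{- Let $F_1$ and $F_2$ be finite subsets of $\mathbb{Z}^2$ such that $F_1$ is uniquely determined by its row and column sums, $|F_1| = |F_2|$, and $F_1 \cap F_2 = \emptyset$. Let $2\alpha = \sum_{j\in\mathbb{Z}} |c_j^{(1)} - c_j^{(2)}| + \sum_{i\in\mathbb{Z}} |r_i^{(1)} - r_i^{(2)}|$. Then \[ |F_1| \le \sum_{i=1}^{\alpha} \left\lfloor \frac{\alpha}{i} \right\rfloor. \]
   Context: For $i \in \mathbb{Z}$, row $i$ is $\{(x,y)\in\mathbb{Z}^2 : x = i\}$ and for $j\in\mathbb{Z}$, column $j$ is $\{(x,y)\in\mathbb{Z}^2: y=j\}$. For $h\in\{1,2\}$, $r_i^{(h)}$ is the number of points of $F_h$ in row $i$ and $c_j^{(h)}$ the number of points of $F_h$ in column $j$. $F_1$ is uniquely determined by its row and column sums if no finite subset of $\mathbb{Z}^2$ other than $F_1$ has the same row sums and column sums. The total error in the line sums is always even, hence written $2\alpha$ with $\alpha$ a nonnegative integer. -}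

module Defs where

open import Data.Nat using (ℕ; suc; _+_; ∣_-_∣; _/_)
open import Data.Integer as ℤ using (ℤ)
open import Data.Product using (_×_; proj₁; proj₂)
open import Data.List using (List; length; filter; map; upTo; deduplicate; _++_)
open import Data.Nat.ListAction using (sum)
open import Data.List.Membership.Propositional using (_∈_)
open import Data.List.Relation.Unary.Unique.Propositional using (Unique)
open import Relation.Binary.PropositionalEquality using (_≡_)
open import Relation.Nullary using (¬_)
open import Function.Bundles using (_⇔_)

-- A point of ℤ²; a point (x , y) lies in row x and column y.
Point : Set
Point = ℤ × ℤ

-- A finite subset of ℤ² is represented by a duplicate-free list of points
-- (the hypothesis 'Unique' is imposed where such sets are quantified).

rowSum : List Point → ℤ → ℕ
rowSum F i = length (filter (λ p → proj₁ p ℤ.≟ i) F)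

colSum : List Point → ℤ → ℕ
colSum F j = length (filter (λ p → proj₂ p ℤ.≟ j) F)

UniquelyDetermined : List Point → Set
UniquelyDetermined F =
  (G : List Point) → Unique G →
  ((i : ℤ) → rowSum G i ≡ rowSum F i) →
  ((j : ℤ) → colSum G j ≡ colSum F j) →
  (p : Point) → (p ∈ G ⇔ p ∈ F)

-- Sum over all i ∈ ℤ of f i, where f is supported on the finite list S
-- (duplicates in S are removed first).
sumOver : List ℤ → (ℤ → ℕ) → ℕ
sumOver S f = sum (map f (deduplicate ℤ._≟_ S))

-- Total line-sum error  Σ_j |c_j^(1) - c_j^(2)| + Σ_i |r_i^(1) - r_i^(2)|.
-- All nonzero terms occur at rows/columns meeting F₁ ∪ F₂.
lineSumError : List Point → List Point → ℕ
lineSumError F₁ F₂ =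
  sumOver (map proj₂ (F₁ ++ F₂)) (λ j → ∣ colSum F₁ j - colSum F₂ j ∣)
  + sumOver (map proj₁ (F₁ ++ F₂)) (λ i → ∣ rowSum F₁ i - rowSum F₂ i ∣)

floorSum : ℕ → ℕ
floorSum α = sum (map (λ k → α / suc k) (upTo α))

-- A uniquely determined set F₁ has no switching component, so its rows are
-- nested: a row with at least as many points as another contains all of its
-- columns. Fix l ≥ 1, let R be the rows of F₁ with at least l points and C the
-- columns containing a point of F₁ in every row of R. Every point of F₁ lies in
-- a row of R or a column of C, the points of R × C lie in both, and no point of
-- F₂ lies in both. As |F₁| = |F₂|, the points of F₁ in rows of R (resp. columns
-- of C) outnumber those of F₂ by at most half the row (resp. column) error,
-- whence |R| |C| + |F₁| ≤ |F₁| + α. The shortest row of R lies inside C, so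
-- l ≤ |C| and |R| ≤ α / l. Finally |F₁| = Σ_x r_x = Σ_{l=1}^{α} |R_l|, as every
-- r_x ≤ α.

module Submission where

open import Defs
open import Level using (Level; 0ℓ)
open import Data.Empty using (⊥; ⊥-elim)
open import Data.Unit using (⊤; tt)
open import Data.Integer as ℤ using (ℤ)
open import Data.List using (List; []; _∷_; [_]; length; filter; map; _++_; _∷ʳ_;
  upTo; deduplicate; cartesianProduct)
open import Data.List.Extrema.Nat using (argmin; argmin-sel; f[argmin]≤f[⊤]; f[argmin]≤f[xs])
open import Data.List.Membership.Propositional using (_∈_; _∉_)
open import Data.List.Membership.Propositional.Properties
  using (∈-filter⁺; ∈-filter⁻; ∈-deduplicate⁺; ∈-map⁺; ∈-++⁺ˡ; ∈-++⁺ʳ; ∈-cartesianProduct⁻)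
open import Data.List.Properties
  using (filter-all; filter-none; filter-notAll; length-filter; length-++; length-map;
         map-cong; map-cong-local; map-++; upTo-∷ʳ)
open import Data.List.Relation.Unary.All as All using (All; []; _∷_)
open import Data.List.Relation.Unary.Any as Any using (here; there)
open import Data.List.Relation.Unary.Unique.Propositional using (Unique; []; _∷_)
open import Data.List.Relation.Unary.Unique.Propositional.Properties
  using (filter⁺; cartesianProduct⁺)
import Data.List.Relation.Unary.Unique.DecPropositional.Properties as UniqueDecProperties
open import Data.Nat using (ℕ; zero; suc; _+_; _*_; _≤_; _<_; z≤n; s≤s; _⊓_; _/_; ∣_-_∣)
open import Data.Nat.Properties
open import Algebra.Properties.CommutativeSemigroup +-commutativeSemigroup using (interchange; x∙yz≈y∙xz)
open import Data.Nat.DivMod using (m*n/n≡m; /-monoˡ-≤)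
open import Data.Nat.ListAction using (sum)
open import Data.Nat.ListAction.Properties using (sum-++)
open import Data.Product using (_×_; _,_; proj₁; proj₂; ∃-syntax)
open import Data.Product.Properties using (≡-dec)
open import Data.Sum using (_⊎_; inj₁; inj₂; [_,_]′)
open import Function using (_∘_; id)
open import Function.Bundles using (Equivalence)
open import Relation.Binary.Definitions using (DecidableEquality)
open import Relation.Binary.PropositionalEquality
  using (_≡_; _≢_; refl; sym; trans; cong; cong₂; subst; module ≡-Reasoning)
open import Relation.Nullary using (Dec; yes; no; ¬_; ¬?)
open import Relation.Unary using (Pred; Decidable)
open import Relation.Unary.Properties using (∁?; _∩?_; _∪?_)

private variable
  a b p q : Level
  A B : Set a

indicator : {P : Set p} → Dec P → ℕ
indicator (yes _) = 1
indicator (no _)  = 0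

count : {P : Pred A p} → Decidable P → List A → ℕ
count P? xs = length (filter P? xs)

module _ {P : Pred A p} (P? : Decidable P) where

  count-∷ : ∀ x xs → count P? (x ∷ xs) ≡ indicator (P? x) + count P? xs
  count-∷ x xs with P? x
  ... | yes _ = refl
  ... | no _  = refl

  count≡sum-indicator : ∀ xs → count P? xs ≡ sum (map (indicator ∘ P?) xs)
  count≡sum-indicator []       = refl
  count≡sum-indicator (x ∷ xs) = trans (count-∷ x xs) (cong (indicator (P? x) +_) (count≡sum-indicator xs))

  length≡count+count-∁ : ∀ xs → length xs ≡ count P? xs + count (∁? P?) xs
  length≡count+count-∁ []       = refl
  length≡count+count-∁ (x ∷ xs) with P? x
  ... | yes _ = cong suc (length≡count+count-∁ xs)
  ... | no _  = trans (cong suc (length≡count+count-∁ xs)) (sym (+-suc _ _))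

  sum-map-partition : ∀ (f : A → ℕ) xs →
    sum (map f xs) ≡ sum (map f (filter P? xs)) + sum (map f (filter (∁? P?) xs))
  sum-map-partition f []       = refl
  sum-map-partition f (x ∷ xs) with P? x
  ... | yes _ = trans (cong (f x +_) (sum-map-partition f xs)) (sym (+-assoc (f x) _ _))
  ... | no _  = trans (cong (f x +_) (sum-map-partition f xs)) (x∙yz≈y∙xz (f x) (sum (map f (filter P? xs))) _)

module _ {P : Pred A p} {Q : Pred A q} (P? : Decidable P) (Q? : Decidable Q) where

  count-∩+count-∪ : ∀ xs → count P? xs + count Q? xs ≡ count (P? ∩? Q?) xs + count (P? ∪? Q?) xs
  count-∩+count-∪ []       = refl
  count-∩+count-∪ (x ∷ xs) = begin
      count P? (x ∷ xs) + count Q? (x ∷ xs)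
    ≡⟨ cong₂ _+_ (count-∷ P? x xs) (count-∷ Q? x xs) ⟩
      indicator (P? x) + count P? xs + (indicator (Q? x) + count Q? xs)
    ≡⟨ interchange (indicator (P? x)) _ _ _ ⟩
      indicator (P? x) + indicator (Q? x) + (count P? xs + count Q? xs)
    ≡⟨ cong₂ _+_ indicators (count-∩+count-∪ xs) ⟩
      indicator ((P? ∩? Q?) x) + indicator ((P? ∪? Q?) x)
        + (count (P? ∩? Q?) xs + count (P? ∪? Q?) xs)
    ≡⟨ interchange (indicator ((P? ∩? Q?) x)) _ _ _ ⟩
      indicator ((P? ∩? Q?) x) + count (P? ∩? Q?) xs
        + (indicator ((P? ∪? Q?) x) + count (P? ∪? Q?) xs)
    ≡⟨ sym (cong₂ _+_ (count-∷ (P? ∩? Q?) x xs) (count-∷ (P? ∪? Q?) x xs)) ⟩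
      count (P? ∩? Q?) (x ∷ xs) + count (P? ∪? Q?) (x ∷ xs)
    ∎
    where
    open ≡-Reasoning
    indicators : indicator (P? x) + indicator (Q? x)
               ≡ indicator ((P? ∩? Q?) x) + indicator ((P? ∪? Q?) x)
    indicators with P? x | Q? x
    ... | yes _ | yes _ = refl
    ... | yes _ | no _  = refl
    ... | no _  | yes _ = refl
    ... | no _  | no _  = refl

module _ {A : Set a} (_≟_ : DecidableEquality A) where

  remove : A → List A → List A
  remove x = filter (λ z → ¬? (z ≟ x))

  remove-⊆ : ∀ {x y xs} → y ∈ remove x xs → y ∈ xs
  remove-⊆ {x} = proj₁ ∘ ∈-filter⁻ (λ z → ¬? (z ≟ x))

  ∈-remove⁺ : ∀ {x y xs} → y ∈ xs → y ≢ x → y ∈ remove x xs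
  ∈-remove⁺ {x} = ∈-filter⁺ (λ z → ¬? (z ≟ x))

  remove-unique : ∀ {x xs} → Unique xs → Unique (remove x xs)
  remove-unique {x} = filter⁺ (λ z → ¬? (z ≟ x))

  length-remove-< : ∀ {x xs} → x ∈ xs → length (remove x xs) < length xs
  length-remove-< {x} {xs} x∈xs =
    filter-notAll (λ z → ¬? (z ≟ x)) xs (Any.map (λ x≡z z≢x → z≢x (sym x≡z)) x∈xs)

  count-remove : ∀ {P : Pred A p} (P? : Decidable P) {x xs} → Unique xs → x ∈ xs →
    count P? xs ≡ indicator (P? x) + count P? (remove x xs)
  count-remove P? {x} {y ∷ xs} (y∉xs ∷ u) x∈ with y ≟ x
  ... | yes refl = trans (count-∷ P? y xs)
        (cong (λ zs → indicator (P? y) + count P? zs)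
          (sym (filter-all (λ z → ¬? (z ≟ y)) (All.map (λ y≢z z≡y → y≢z (sym z≡y)) y∉xs))))
  ... | no y≢x with x∈
  ...   | here x≡y  = ⊥-elim (y≢x (sym x≡y))
  ...   | there x∈xs = begin
      count P? (y ∷ xs)
    ≡⟨ count-∷ P? y xs ⟩
      indicator (P? y) + count P? xs
    ≡⟨ cong (indicator (P? y) +_) (count-remove P? u x∈xs) ⟩
      indicator (P? y) + (indicator (P? x) + count P? (remove x xs))
    ≡⟨ x∙yz≈y∙xz (indicator (P? y)) (indicator (P? x)) _ ⟩
      indicator (P? x) + (indicator (P? y) + count P? (remove x xs))
    ≡⟨ cong (indicator (P? x) +_) (sym (count-∷ P? y (remove x xs))) ⟩
      indicator (P? x) + count P? (y ∷ remove x xs)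
    ∎
    where open ≡-Reasoning

  sum-indicator-∉ : ∀ {k} xs → k ∉ xs → sum (map (λ x → indicator (k ≟ x)) xs) ≡ 0
  sum-indicator-∉ {k} []       _    = refl
  sum-indicator-∉ {k} (y ∷ xs) k∉ with k ≟ y
  ... | yes k≡y = ⊥-elim (k∉ (here k≡y))
  ... | no _    = sum-indicator-∉ xs (k∉ ∘ there)

  sum-indicator-∈ : ∀ {k xs} → Unique xs → k ∈ xs → sum (map (λ x → indicator (k ≟ x)) xs) ≡ 1
  sum-indicator-∈ {k} {y ∷ xs} (y∉xs ∷ u) k∈ with k ≟ y
  ... | yes refl = cong suc (sum-indicator-∉ xs (λ k∈xs → All.lookup y∉xs k∈xs refl))
  ... | no k≢y with k∈
  ...   | here k≡y   = ⊥-elim (k≢y k≡y)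
  ...   | there k∈xs = sum-indicator-∈ u k∈xs

  sum-indicator-filter : ∀ {P : Pred A p} (P? : Decidable P) {k xs} → Unique xs → k ∈ xs →
    sum (map (λ x → indicator (k ≟ x)) (filter P? xs)) ≡ indicator (P? k)
  sum-indicator-filter P? {k} {xs} u k∈ with P? k
  ... | yes Pk = sum-indicator-∈ (filter⁺ P? u) (∈-filter⁺ P? k∈ Pk)
  ... | no ¬Pk = sum-indicator-∉ (filter P? xs) (¬Pk ∘ proj₂ ∘ ∈-filter⁻ P? {xs = xs})

injection⇒length≤ : DecidableEquality B → (f : A → B) {xs : List A} {ys : List B} →
  Unique xs → (∀ {u v} → u ∈ xs → v ∈ xs → f u ≡ f v → u ≡ v) →
  (∀ {u} → u ∈ xs → f u ∈ ys) → length xs ≤ length ys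
injection⇒length≤ _≟_ f {[]}     _            _   _   = z≤n
injection⇒length≤ _≟_ f {x ∷ xs} {ys} (x∉xs ∷ uxs) inj mem =
  ≤-trans (s≤s (injection⇒length≤ _≟_ f uxs (λ u∈ v∈ → inj (there u∈) (there v∈)) mem′))
          (length-remove-< _≟_ (mem (here refl)))
  where
  mem′ : ∀ {u} → u ∈ xs → f u ∈ remove _≟_ (f x) ys
  mem′ u∈xs = ∈-remove⁺ _≟_ (mem (there u∈xs))
    (λ fu≡fx → All.lookup x∉xs u∈xs (inj (here refl) (there u∈xs) (sym fu≡fx)))

∃-minimum : (f : A → ℕ) {x : A} {xs : List A} → x ∈ xs →
  ∃[ m ] m ∈ xs × All (λ z → f m ≤ f z) xs
∃-minimum f {xs = y ∷ ys} _ =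
  argmin f y ys , [ here , there ]′ (argmin-sel f y ys) ,
  f[argmin]≤f[⊤] {f = f} y ys ∷ f[argmin]≤f[xs] {f = f} y ys

length-cartesianProduct : (xs : List A) (ys : List B) →
  length (cartesianProduct xs ys) ≡ length xs * length ys
length-cartesianProduct []       ys = refl
length-cartesianProduct (x ∷ xs) ys =
  trans (length-++ (map (x ,_) ys)) (cong₂ _+_ (length-map (x ,_) ys) (length-cartesianProduct xs ys))

length*-monoʳ-≤ : (xs : List A) {m n : ℕ} → (∀ {x} → x ∈ xs → m ≤ n) →
  length xs * m ≤ length xs * n
length*-monoʳ-≤ []       _  = z≤n
length*-monoʳ-≤ (x ∷ xs) m≤n = *-monoʳ-≤ (length (x ∷ xs)) (m≤n (here refl))

≤-length* : ∀ {x : A} {xs} m → x ∈ xs → m ≤ length xs * m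
≤-length* {xs = _ ∷ xs} m _ = m≤m+n m (length xs * m)

sum-map-0 : (xs : List A) → sum (map (λ _ → 0) xs) ≡ 0
sum-map-0 []       = refl
sum-map-0 (_ ∷ xs) = sum-map-0 xs

sum-map-+ : (f g : A → ℕ) (xs : List A) →
  sum (map (λ x → f x + g x) xs) ≡ sum (map f xs) + sum (map g xs)
sum-map-+ f g []       = refl
sum-map-+ f g (x ∷ xs) = trans (cong (f x + g x +_) (sum-map-+ f g xs)) (interchange (f x) (g x) _ _)

sum-map-mono-≤ : {f g : A → ℕ} → (∀ x → f x ≤ g x) → (xs : List A) → sum (map f xs) ≤ sum (map g xs)
sum-map-mono-≤ f≤g []       = z≤n
sum-map-mono-≤ f≤g (x ∷ xs) = +-mono-≤ (f≤g x) (sum-map-mono-≤ f≤g xs)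

sum-map-swap : (g : A → B → ℕ) (xs : List A) (ys : List B) →
  sum (map (λ x → sum (map (g x) ys)) xs) ≡ sum (map (λ y → sum (map (λ x → g x y) xs)) ys)
sum-map-swap g []       ys = sym (sum-map-0 ys)
sum-map-swap g (x ∷ xs) ys = trans (cong (sum (map (g x) ys) +_) (sum-map-swap g xs ys))
  (sym (sum-map-+ (g x) (λ y → sum (map (λ x → g x y) xs)) ys))

⊓-suc : ∀ m n → n ⊓ m + indicator (suc m ≤? n) ≡ n ⊓ suc m
⊓-suc m n with suc m ≤? n
... | yes m<n = trans (cong (_+ 1) (m≥n⇒m⊓n≡n (<⇒≤ m<n))) (trans (+-comm m 1) (sym (m≥n⇒m⊓n≡n m<n)))
... | no m≮n  = trans (+-identityʳ (n ⊓ m))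
                  (trans (m≤n⇒m⊓n≡m n≤m) (sym (m≤n⇒m⊓n≡m (m≤n⇒m≤1+n n≤m))))
  where n≤m = ≮⇒≥ m≮n

layer-cake : ∀ m n → sum (map (λ k → indicator (suc k ≤? n)) (upTo m)) ≡ n ⊓ m
layer-cake zero    n = sym (⊓-zeroʳ n)
layer-cake (suc m) n = begin
    sum (map g (upTo (suc m)))         ≡⟨ cong (sum ∘ map g) (sym (upTo-∷ʳ m)) ⟩
    sum (map g (upTo m ∷ʳ m))          ≡⟨ cong sum (map-++ g (upTo m) [ m ]) ⟩
    sum (map g (upTo m) ++ [ g m ])    ≡⟨ sum-++ (map g (upTo m)) [ g m ] ⟩
    sum (map g (upTo m)) + (g m + 0)   ≡⟨ cong₂ _+_ (layer-cake m n) (+-identityʳ (g m)) ⟩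
    n ⊓ m + g m                        ≡⟨ ⊓-suc m n ⟩
    n ⊓ suc m                          ∎
  where
  open ≡-Reasoning
  g : ℕ → ℕ
  g k = indicator (suc k ≤? n)

twice-≤-by-balance : ∀ {a₁ a₂ c₁ c₂ e₁ e₂} → a₁ + c₁ ≡ a₂ + c₂ →
  a₁ ≤ a₂ + e₁ → c₂ ≤ c₁ + e₂ → 2 * a₁ ≤ 2 * a₂ + (e₁ + e₂)
twice-≤-by-balance {a₁} {a₂} {c₁} {c₂} {e₁} {e₂} balance a₁≤ c₂≤ = begin
    2 * a₁                    ≡⟨ cong (a₁ +_) (+-identityʳ a₁) ⟩
    a₁ + a₁                   ≤⟨ +-mono-≤ a₁≤ a₁≤′ ⟩
    (a₂ + e₁) + (a₂ + e₂)     ≡⟨ interchange a₂ e₁ a₂ e₂ ⟩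
    (a₂ + a₂) + (e₁ + e₂)     ≡⟨ cong (λ n → a₂ + n + (e₁ + e₂)) (sym (+-identityʳ a₂)) ⟩
    2 * a₂ + (e₁ + e₂)        ∎
  where
  open ≤-Reasoning
  a₁≤′ : a₁ ≤ a₂ + e₂
  a₁≤′ = +-cancelʳ-≤ c₁ a₁ (a₂ + e₂) (begin
    a₁ + c₁          ≡⟨ balance ⟩
    a₂ + c₂          ≤⟨ +-monoʳ-≤ a₂ c₂≤ ⟩
    a₂ + (c₁ + e₂)   ≡⟨ cong (a₂ +_) (+-comm c₁ e₂) ⟩
    a₂ + (e₂ + c₁)   ≡⟨ sym (+-assoc a₂ e₂ c₁) ⟩
    a₂ + e₂ + c₁     ∎)

-- With key = proj₁ (resp. proj₂), the fibre of a set of points over x is its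
-- row (resp. column) sum at x.
module Fibres {A : Set a} {K : Set b} (_≟_ : DecidableEquality K) (key : A → K) where

  fibre : List A → K → ℕ
  fibre F x = count (λ q → key q ≟ x) F

  keys : List A → List K
  keys F = deduplicate _≟_ (map key F)

  keys-unique : ∀ F → Unique (keys F)
  keys-unique F = UniqueDecProperties.deduplicate-! _≟_ (map key F)

  ∈-keys : ∀ {q F} → q ∈ F → key q ∈ keys F
  ∈-keys q∈F = ∈-deduplicate⁺ _≟_ (∈-map⁺ key q∈F)

  module _ {P : Pred K p} (P? : Decidable P) where

    sum-fibres : ∀ {D} F → Unique D → (∀ {q} → q ∈ F → key q ∈ D) →
      sum (map (fibre F) (filter P? D)) ≡ count (P? ∘ key) F
    sum-fibres {D} []      _  _     = sum-map-0 (filter P? D)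
    sum-fibres {D} (q ∷ F) uD keys∈ = begin
        sum (map (fibre (q ∷ F)) (filter P? D))
      ≡⟨ cong sum (map-cong (λ x → count-∷ (λ q → key q ≟ x) q F) (filter P? D)) ⟩
        sum (map (λ x → indicator (key q ≟ x) + fibre F x) (filter P? D))
      ≡⟨ sum-map-+ (λ x → indicator (key q ≟ x)) (fibre F) (filter P? D) ⟩
        sum (map (λ x → indicator (key q ≟ x)) (filter P? D)) + sum (map (fibre F) (filter P? D))
      ≡⟨ cong₂ _+_ (sum-indicator-filter _≟_ P? uD (keys∈ (here refl)))
                   (sum-fibres F uD (keys∈ ∘ there)) ⟩
        indicator (P? (key q)) + count (P? ∘ key) F
      ≡⟨ sym (count-∷ (P? ∘ key) q F) ⟩
        count (P? ∘ key) (q ∷ F)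
      ∎
      where open ≡-Reasoning

    count-≤-sum-fibre-excess : ∀ {D} F G (d : K → ℕ) → Unique D →
      (∀ {q} → q ∈ F → key q ∈ D) → (∀ {q} → q ∈ G → key q ∈ D) →
      (∀ x → fibre F x ≤ fibre G x + d x) →
      count (P? ∘ key) F ≤ count (P? ∘ key) G + sum (map d (filter P? D))
    count-≤-sum-fibre-excess {D} F G d uD keysF keysG excess = begin
        count (P? ∘ key) F
      ≡⟨ sym (sum-fibres F uD keysF) ⟩
        sum (map (fibre F) (filter P? D))
      ≤⟨ sum-map-mono-≤ excess (filter P? D) ⟩
        sum (map (λ x → fibre G x + d x) (filter P? D))
      ≡⟨ sum-map-+ (fibre G) d (filter P? D) ⟩
        sum (map (fibre G) (filter P? D)) + sum (map d (filter P? D))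
      ≡⟨ cong (_+ sum (map d (filter P? D))) (sum-fibres G uD keysG) ⟩
        count (P? ∘ key) G + sum (map d (filter P? D))
      ∎
      where open ≤-Reasoning

  module _ {P : Pred K p} (P? : Decidable P) where

    -- Equal sizes let a deficit outside P be traded for an excess inside P,
    -- so each unit of excess is paid for twice in the total discrepancy.
    twice-count-≤ : ∀ F G → length F ≡ length G →
      2 * count (P? ∘ key) F
        ≤ 2 * count (P? ∘ key) G + sum (map (λ x → ∣ fibre F x - fibre G x ∣) (keys (F ++ G)))
    twice-count-≤ F G |F|≡|G| = subst (2 * count (P? ∘ key) F ≤_)
      (cong (2 * count (P? ∘ key) G +_) (sym (sum-map-partition P? error D)))
      (twice-≤-by-balance balance
        (count-≤-sum-fibre-excess P? F G error uD keysF keysG (λ x → m≤n+∣m-n∣ (fibre F x) (fibre G x)))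
        (count-≤-sum-fibre-excess (∁? P?) G F error uD keysG keysF
          (λ x → m≤n+∣n-m∣ (fibre G x) (fibre F x))))
      where
      D = keys (F ++ G)
      uD = keys-unique (F ++ G)
      error : K → ℕ
      error x = ∣ fibre F x - fibre G x ∣
      keysF : ∀ {q} → q ∈ F → key q ∈ D
      keysF = ∈-keys ∘ ∈-++⁺ˡ
      keysG : ∀ {q} → q ∈ G → key q ∈ D
      keysG = ∈-keys ∘ ∈-++⁺ʳ F
      balance : count (P? ∘ key) F + count (∁? (P? ∘ key)) F
              ≡ count (P? ∘ key) G + count (∁? (P? ∘ key)) G
      balance = trans (sym (length≡count+count-∁ (P? ∘ key) F))
                  (trans |F|≡|G| (length≡count+count-∁ (P? ∘ key) G))

  sum-all-fibres : ∀ {D} F → Unique D → (∀ {q} → q ∈ F → key q ∈ D) →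
    sum (map (fibre F) D) ≡ length F
  sum-all-fibres {D} F uD keys∈ = begin
      sum (map (fibre F) D)
    ≡⟨ cong (sum ∘ map (fibre F)) (sym (filter-all always (All.universal _ D))) ⟩
      sum (map (fibre F) (filter always D))
    ≡⟨ sum-fibres always F uD keys∈ ⟩
      count (always ∘ key) F
    ≡⟨ cong length (filter-all (always ∘ key) (All.universal _ F)) ⟩
      length F
    ∎
    where
    open ≡-Reasoning
    always : Decidable {A = K} (λ _ → ⊤)
    always _ = yes tt

_≟ᵖ_ : DecidableEquality Point
_≟ᵖ_ = ≡-dec ℤ._≟_ ℤ._≟_

open import Data.List.Membership.DecPropositional _≟ᵖ_ using (_∈?_)

row : List Point → ℤ → List Point
row F x = filter (λ p → proj₁ p ℤ.≟ x) F

∈-row⁺ : ∀ {F x y} → (x , y) ∈ F → (x , y) ∈ row F x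
∈-row⁺ xy∈F = ∈-filter⁺ (λ p → proj₁ p ℤ.≟ _) xy∈F refl

∈-row⁻ : ∀ {F x p} → p ∈ row F x → (x , proj₂ p) ∈ F
∈-row⁻ {F} {x} p∈ with ∈-filter⁻ (λ p → proj₁ p ℤ.≟ x) {xs = F} p∈
... | p∈F , refl = p∈F

row-⊆ : ∀ {F x p} → p ∈ row F x → p ∈ F
row-⊆ {F} {x} = proj₁ ∘ ∈-filter⁻ (λ p → proj₁ p ℤ.≟ x) {xs = F}

row-unique : ∀ {F} x → Unique F → Unique (row F x)
row-unique x = filter⁺ (λ p → proj₁ p ℤ.≟ x)

row-injective : ∀ {F x u v} → u ∈ row F x → v ∈ row F x → proj₂ u ≡ proj₂ v → u ≡ v
row-injective {F} {x} u∈ v∈ refl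
  with ∈-filter⁻ (λ p → proj₁ p ℤ.≟ x) {xs = F} u∈
     | ∈-filter⁻ (λ p → proj₁ p ℤ.≟ x) {xs = F} v∈
... | _ , refl | _ , refl = refl

-- Replacing the corners (a , b), (c , d) by (a , d), (c , b) preserves all
-- line sums, so a uniquely determined set never admits such a switch.
no-switch : ∀ {F} → Unique F → UniquelyDetermined F → ∀ {a b c d} →
  (a , b) ∈ F → (c , d) ∈ F → (a , d) ∉ F → (c , b) ∉ F → ⊥
no-switch {F} uF det {a} {b} {c} {d} ab∈F cd∈F ad∉F cb∉F =
  ad∉F (Equivalence.to (det G uG G-rows G-cols (a , d)) (here refl))
  where
  a≢c : a ≢ c
  a≢c refl = cb∉F ab∈F
  H₁ H G : List Point
  H₁ = remove _≟ᵖ_ (c , d) F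
  H  = remove _≟ᵖ_ (a , b) H₁
  G  = (a , d) ∷ (c , b) ∷ H
  H⊆F : ∀ {p} → p ∈ H → p ∈ F
  H⊆F = remove-⊆ _≟ᵖ_ ∘ remove-⊆ _≟ᵖ_
  uH₁ : Unique H₁
  uH₁ = remove-unique _≟ᵖ_ uF
  ∉H : ∀ {p} → p ∉ F → All (p ≢_) H
  ∉H p∉F = All.tabulate (λ q∈H p≡q → p∉F (subst (_∈ F) (sym p≡q) (H⊆F q∈H)))
  uG : Unique G
  uG = ((λ ad≡cb → a≢c (cong proj₁ ad≡cb)) ∷ ∉H ad∉F) ∷ ∉H cb∉F ∷ remove-unique _≟ᵖ_ uH₁
  count-F : ∀ {P : Pred Point 0ℓ} (P? : Decidable P) →
    count P? F ≡ indicator (P? (c , d)) + (indicator (P? (a , b)) + count P? H)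
  count-F P? = trans (count-remove _≟ᵖ_ P? uF cd∈F)
    (cong (indicator (P? (c , d)) +_)
      (count-remove _≟ᵖ_ P? uH₁ (∈-remove⁺ _≟ᵖ_ ab∈F (λ ab≡cd → a≢c (cong proj₁ ab≡cd)))))
  count-G : ∀ {P : Pred Point 0ℓ} (P? : Decidable P) →
    count P? G ≡ indicator (P? (a , d)) + (indicator (P? (c , b)) + count P? H)
  count-G P? = trans (count-∷ P? (a , d) _) (cong (indicator (P? (a , d)) +_) (count-∷ P? (c , b) H))
  G-rows : ∀ i → rowSum G i ≡ rowSum F i
  G-rows i = trans (count-G (λ p → proj₁ p ℤ.≟ i))
    (trans (x∙yz≈y∙xz (indicator (a ℤ.≟ i)) (indicator (c ℤ.≟ i)) _)
      (sym (count-F (λ p → proj₁ p ℤ.≟ i))))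
  G-cols : ∀ j → colSum G j ≡ colSum F j
  G-cols j = trans (count-G (λ p → proj₂ p ℤ.≟ j)) (sym (count-F (λ p → proj₂ p ℤ.≟ j)))

RowsNested : List Point → Set
RowsNested F = ∀ {x x′ y} → (x , y) ∈ F → rowSum F x ≤ rowSum F x′ → (x′ , y) ∈ F

module _ {F : List Point} (uF : Unique F) (det : UniquelyDetermined F) where

  row-inclusion : ∀ {x x′ y y′} →
    (x , y) ∈ F → (x′ , y) ∉ F → (x′ , y′) ∈ F → (x , y′) ∈ F
  row-inclusion {x} {y′ = y′} xy∈F x′y∉F x′y′∈F with (x , y′) ∈? F
  ... | yes xy′∈F = xy′∈F
  ... | no xy′∉F  = ⊥-elim (no-switch uF det xy∈F x′y′∈F xy′∉F x′y∉F)

  rowSum-< : ∀ {x x′ y} → (x , y) ∈ F → (x′ , y) ∉ F → rowSum F x′ < rowSum F x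
  rowSum-< {x} {x′} {y} xy∈F x′y∉F =
    injection⇒length≤ _≟ᵖ_ (λ p → x , proj₂ p) uxs inj mem
    where
    x′y∉row : (x′ , y) ∉ row F x′
    x′y∉row = x′y∉F ∘ row-⊆
    uxs : Unique ((x′ , y) ∷ row F x′)
    uxs = All.tabulate (λ p∈ x′y≡p → x′y∉row (subst (_∈ row F x′) (sym x′y≡p) p∈))
        ∷ row-unique x′ uF
    inj : ∀ {u v} → u ∈ (x′ , y) ∷ row F x′ → v ∈ (x′ , y) ∷ row F x′ →
          (x , proj₂ u) ≡ (x , proj₂ v) → u ≡ v
    inj (here refl) (here refl) _    = refl
    inj (here refl) (there v∈) refl = ⊥-elim (x′y∉F (∈-row⁻ v∈))
    inj (there u∈) (here refl) refl = ⊥-elim (x′y∉F (∈-row⁻ u∈))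
    inj (there u∈) (there v∈) eq    = row-injective {F} {x′} u∈ v∈ (cong proj₂ eq)
    mem : ∀ {u} → u ∈ (x′ , y) ∷ row F x′ → (x , proj₂ u) ∈ row F x
    mem (here refl) = ∈-row⁺ xy∈F
    mem (there u∈)  = ∈-row⁺ (row-inclusion xy∈F x′y∉F (∈-row⁻ u∈))

  rows-nested : RowsNested F
  rows-nested {x} {x′} {y} xy∈F rx≤rx′ with (x′ , y) ∈? F
  ... | yes x′y∈F = x′y∈F
  ... | no x′y∉F  = ⊥-elim (<⇒≱ (rowSum-< xy∈F x′y∉F) rx≤rx′)

module RowFibres    = Fibres {A = Point} ℤ._≟_ proj₁
module ColumnFibres = Fibres {A = Point} ℤ._≟_ proj₂

module _ (F₁ F₂ : List Point) (|F₁|≡|F₂| : length F₁ ≡ length F₂)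
         (α : ℕ) (error≡2α : lineSumError F₁ F₂ ≡ 2 * α) where

  line-count-bound : ∀ {P Q : Pred ℤ 0ℓ} (P? : Decidable P) (Q? : Decidable Q) →
    (∀ {q} → q ∈ F₂ → ¬ (P (proj₁ q) × Q (proj₂ q))) →
    count (P? ∘ proj₁) F₁ + count (Q? ∘ proj₂) F₁ ≤ length F₁ + α
  line-count-bound P? Q? F₂-avoids = *-cancelˡ-≤ 2 (begin
      2 * (a₁ + b₁)
    ≡⟨ *-distribˡ-+ 2 a₁ b₁ ⟩
      2 * a₁ + 2 * b₁
    ≤⟨ +-mono-≤ (RowFibres.twice-count-≤ P? F₁ F₂ |F₁|≡|F₂|)
                (ColumnFibres.twice-count-≤ Q? F₁ F₂ |F₁|≡|F₂|) ⟩
      (2 * a₂ + rowError) + (2 * b₂ + columnError)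
    ≡⟨ interchange (2 * a₂) rowError (2 * b₂) columnError ⟩
      (2 * a₂ + 2 * b₂) + (rowError + columnError)
    ≡⟨ cong₂ _+_ (sym (*-distribˡ-+ 2 a₂ b₂)) (+-comm rowError columnError) ⟩
      2 * (a₂ + b₂) + lineSumError F₁ F₂
    ≤⟨ +-mono-≤ (*-monoʳ-≤ 2 F₂-bound) (≤-reflexive error≡2α) ⟩
      2 * length F₁ + 2 * α
    ≡⟨ sym (*-distribˡ-+ 2 (length F₁) α) ⟩
      2 * (length F₁ + α)
    ∎)
    where
    open ≤-Reasoning
    a₁ = count (P? ∘ proj₁) F₁
    a₂ = count (P? ∘ proj₁) F₂
    b₁ = count (Q? ∘ proj₂) F₁
    b₂ = count (Q? ∘ proj₂) F₂
    rowError = sumOver (map proj₁ (F₁ ++ F₂)) (λ i → ∣ rowSum F₁ i - rowSum F₂ i ∣)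
    columnError = sumOver (map proj₂ (F₁ ++ F₂)) (λ j → ∣ colSum F₁ j - colSum F₂ j ∣)
    F₂-bound : a₂ + b₂ ≤ length F₁
    F₂-bound = begin
        a₂ + b₂
      ≡⟨ count-∩+count-∪ (P? ∘ proj₁) (Q? ∘ proj₂) F₂ ⟩
        count ((P? ∘ proj₁) ∩? (Q? ∘ proj₂)) F₂ + count ((P? ∘ proj₁) ∪? (Q? ∘ proj₂)) F₂
      ≡⟨ cong (λ qs → length qs + count ((P? ∘ proj₁) ∪? (Q? ∘ proj₂)) F₂)
              (filter-none ((P? ∘ proj₁) ∩? (Q? ∘ proj₂)) (All.tabulate F₂-avoids)) ⟩
        count ((P? ∘ proj₁) ∪? (Q? ∘ proj₂)) F₂
      ≤⟨ length-filter ((P? ∘ proj₁) ∪? (Q? ∘ proj₂)) F₂ ⟩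
        length F₂
      ≡⟨ sym |F₁|≡|F₂| ⟩
        length F₁
      ∎

module Layers (F₁ F₂ : List Point) (u₁ : Unique F₁) (nested : RowsNested F₁)
              (disjoint : (p : Point) → p ∈ F₁ → p ∉ F₂) (|F₁|≡|F₂| : length F₁ ≡ length F₂)
              (α : ℕ) (error≡2α : lineSumError F₁ F₂ ≡ 2 * α) where

  rows columns : List ℤ
  rows    = RowFibres.keys (F₁ ++ F₂)
  columns = ColumnFibres.keys (F₁ ++ F₂)

  Long : ℕ → Pred ℤ 0ℓ
  Long l x = l ≤ rowSum F₁ x

  long? : ∀ l → Decidable (Long l)
  long? l x = l ≤? rowSum F₁ x

  long-rows : ℕ → List ℤ
  long-rows l = filter (long? l) rows

  Full : ℕ → Pred ℤ 0ℓ
  Full l y = All (λ x → (x , y) ∈ F₁) (long-rows l)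

  full? : ∀ l → Decidable (Full l)
  full? l y = All.all? (λ x → (x , y) ∈? F₁) (long-rows l)

  full-columns : ℕ → List ℤ
  full-columns l = filter (full? l) columns

  long-rows⁻ : ∀ {l x} → x ∈ long-rows l → Long l x
  long-rows⁻ {l} = proj₂ ∘ ∈-filter⁻ (long? l) {xs = rows}

  long-or-full : ∀ l {q} → q ∈ F₁ → Long l (proj₁ q) ⊎ Full l (proj₂ q)
  long-or-full l {x , y} xy∈F₁ with long? l x
  ... | yes long = inj₁ long
  ... | no short = inj₂ (All.tabulate (λ x′∈ →
    nested xy∈F₁ (≤-trans (<⇒≤ (≰⇒> short)) (long-rows⁻ x′∈))))

  F₂-avoids : ∀ l {q} → q ∈ F₂ → ¬ (Long l (proj₁ q) × Full l (proj₂ q))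
  F₂-avoids l {q} q∈F₂ (long , full) =
    disjoint q (All.lookup full (∈-filter⁺ (long? l) (RowFibres.∈-keys (∈-++⁺ʳ F₁ q∈F₂)) long))
      q∈F₂

  long×full-bound : ∀ l → length (long-rows l) * length (full-columns l) ≤ α
  long×full-bound l = +-cancelʳ-≤ (length F₁) _ α (begin
      length (long-rows l) * length (full-columns l) + length F₁
    ≤⟨ +-mono-≤ grid-bound
         (≤-reflexive (sym (cong length (filter-all long∪full? (All.tabulate (long-or-full l)))))) ⟩
      count long∩full? F₁ + count long∪full? F₁
    ≡⟨ sym (count-∩+count-∪ (long? l ∘ proj₁) (full? l ∘ proj₂) F₁) ⟩
      count (long? l ∘ proj₁) F₁ + count (full? l ∘ proj₂) F₁
    ≤⟨ line-count-bound F₁ F₂ |F₁|≡|F₂| α error≡2α (long? l) (full? l) (F₂-avoids l) ⟩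
      length F₁ + α
    ≡⟨ +-comm (length F₁) α ⟩
      α + length F₁
    ∎)
    where
    open ≤-Reasoning
    long∩full? = (long? l ∘ proj₁) ∩? (full? l ∘ proj₂)
    long∪full? = (long? l ∘ proj₁) ∪? (full? l ∘ proj₂)
    grid : List Point
    grid = cartesianProduct (long-rows l) (full-columns l)
    grid⊆ : ∀ {p} → p ∈ grid → p ∈ filter long∩full? F₁
    grid⊆ p∈ with ∈-cartesianProduct⁻ (long-rows l) (full-columns l) p∈
    ... | x∈ , y∈ = ∈-filter⁺ long∩full? (All.lookup full x∈) (long-rows⁻ x∈ , full)
      where full = proj₂ (∈-filter⁻ (full? l) {xs = columns} y∈)
    grid-bound : length (long-rows l) * length (full-columns l) ≤ count long∩full? F₁
    grid-bound = begin
        length (long-rows l) * length (full-columns l)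
      ≡⟨ sym (length-cartesianProduct (long-rows l) (full-columns l)) ⟩
        length grid
      ≤⟨ injection⇒length≤ _≟ᵖ_ id
           (cartesianProduct⁺ (filter⁺ (long? l) (RowFibres.keys-unique (F₁ ++ F₂)))
                              (filter⁺ (full? l) (ColumnFibres.keys-unique (F₁ ++ F₂))))
           (λ _ _ eq → eq) grid⊆ ⟩
        count long∩full? F₁
      ∎

  -- Nestedness makes every column of the shortest long row full.
  ≤-full-columns : ∀ l {x} → x ∈ long-rows l → l ≤ length (full-columns l)
  ≤-full-columns l x∈ with ∃-minimum (rowSum F₁) x∈
  ... | xₘ , xₘ∈ , xₘ-shortest = ≤-trans (long-rows⁻ xₘ∈)
    (injection⇒length≤ ℤ._≟_ proj₂ (row-unique xₘ u₁) (row-injective {F₁} {xₘ}) mem)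
    where
    mem : ∀ {p} → p ∈ row F₁ xₘ → proj₂ p ∈ full-columns l
    mem p∈ = ∈-filter⁺ (full? l) (ColumnFibres.∈-keys (∈-++⁺ˡ (row-⊆ {F₁} {xₘ} p∈)))
               (All.map (nested (∈-row⁻ p∈)) xₘ-shortest)

  long-rows-bound : ∀ l → length (long-rows l) * l ≤ α
  long-rows-bound l = ≤-trans (length*-monoʳ-≤ (long-rows l) (≤-full-columns l)) (long×full-bound l)

  rowSum≤α : ∀ {x} → x ∈ rows → rowSum F₁ x ≤ α
  rowSum≤α {x} x∈ = ≤-trans (≤-length* (rowSum F₁ x) x∈long) (long-rows-bound (rowSum F₁ x))
    where x∈long = ∈-filter⁺ (long? (rowSum F₁ x)) x∈ ≤-refl

  length-long-rows≤ : ∀ k → length (long-rows (suc k)) ≤ α / suc k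
  length-long-rows≤ k = ≤-trans (≤-reflexive (sym (m*n/n≡m (length (long-rows (suc k))) (suc k))))
                                (/-monoˡ-≤ (suc k) (long-rows-bound (suc k)))

  length≡sum-long-rows : length F₁ ≡ sum (map (λ k → length (long-rows (suc k))) (upTo α))
  length≡sum-long-rows = begin
      length F₁
    ≡⟨ sym (RowFibres.sum-all-fibres F₁ (RowFibres.keys-unique (F₁ ++ F₂))
             (RowFibres.∈-keys ∘ ∈-++⁺ˡ)) ⟩
      sum (map (rowSum F₁) rows)
    ≡⟨ cong sum (map-cong-local (All.tabulate λ x∈ →
         sym (trans (layer-cake α _) (m≤n⇒m⊓n≡m (rowSum≤α x∈))))) ⟩
      sum (map (λ x → sum (map (λ k → indicator (long? (suc k) x)) (upTo α))) rows)
    ≡⟨ sum-map-swap (λ x k → indicator (long? (suc k) x)) rows (upTo α) ⟩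
      sum (map (λ k → sum (map (indicator ∘ long? (suc k)) rows)) (upTo α))
    ≡⟨ cong sum (map-cong (λ k → sym (count≡sum-indicator (long? (suc k)) rows)) (upTo α)) ⟩
      sum (map (λ k → length (long-rows (suc k))) (upTo α))
    ∎
    where open ≡-Reasoning

theorem4 : (F₁ F₂ : List Point) → Unique F₁ → Unique F₂ →
    UniquelyDetermined F₁ →
    length F₁ ≡ length F₂ →
    ((p : Point) → p ∈ F₁ → p ∉ F₂) →
    (α : ℕ) → lineSumError F₁ F₂ ≡ 2 * α →
    length F₁ ≤ floorSum α
theorem4 F₁ F₂ u₁ _ det |F₁|≡|F₂| disjoint α error≡2α = begin
    length F₁
  ≡⟨ length≡sum-long-rows ⟩
    sum (map (λ k → length (long-rows (suc k))) (upTo α))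
  ≤⟨ sum-map-mono-≤ length-long-rows≤ (upTo α) ⟩
    floorSum α
  ∎
  where
  open ≤-Reasoning
  open Layers F₁ F₂ u₁ (rows-nested u₁ det) disjoint |F₁|≡|F₂| α error≡2α
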